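{- Let $G=(V,E)$ be a simple graph on a finite set $V$, and let $I=[(i_1,\dots,i_m)]$ be a directed cycle of $G$. An acyclic orientation $\omega$ of $G$ contains a toric directed path lying in the cyclic equivalence class $I$ (i.e. some cyclic shift of $(i_1,\dots,i_m)$ is a toric directed path in $\omega$) if and only if $\nu_I(\omega)=m-2$.
   Context: A directed cycle of $G$ is a cyclic equivalence class $I=[(i_1,\dots,i_m)]$ (the set of all cyclic shifts of the sequence) of distinct vertices with $m\ge3$ such that $\{i_j,i_{j+1}\}\in E$ for $j=1,\dots,m$, indices taken modulo $m$. For an acyclic orientation $\omega$ of $G$, Coleman's function $\nu_I(\omega)$ is the number of edges $\{i_j,i_{j+1}\}$ ($j=1,\dots,m$, mod $m$) that $\omega$ orients $i_j\to i_{j+1}$ minus the number that $\omega$ orients $i_{j+1}\to i_j$. A sequence $(j_1,\dots,j_m)$ of distinct vertices is a toric directed path in $\omega$ if $\omega$ contains the directed edges $j_1\to j_2,\dots,j_{m-1}\to j_m$ and $j_1\to j_m$. -}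

module Defs where

open import Data.Nat using (ℕ; zero; suc; _≤_; _<_; _+_; _∸_; s≤s; z≤n; NonZero; >-nonZero)
open import Data.Nat.Properties using (<-≤-trans)
open import Data.Nat.DivMod using (_mod_)
open import Data.Fin using (Fin; toℕ; fromℕ<)
open import Data.Bool using (Bool; true; false)
open import Data.Integer using (ℤ) renaming (_+_ to _+ℤ_; _-_ to _-ℤ_; +_ to ⁺_)
open import Data.List using (List; foldr; map; allFin)
open import Data.Product using (Σ; _×_; _,_)
open import Data.Sum using (_⊎_)
open import Relation.Binary.PropositionalEquality using (_≡_)
open import Relation.Binary.Construct.Closure.Transitive using (TransClosure)
open import Relation.Nullary using (¬_)
open import Function.Definitions using (Injective)

record SimpleGraph (n : ℕ) : Set where
  field
    adj   : Fin n → Fin n → Bool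
    sym   : ∀ i j → adj i j ≡ adj j i
    irref : ∀ i → adj i i ≡ false
open SimpleGraph public

record Orientation {n : ℕ} (G : SimpleGraph n) : Set where
  field
    dir     : Fin n → Fin n → Bool
    dir⇒adj : ∀ i j → dir i j ≡ true → adj G i j ≡ true
    adj⇒dir : ∀ i j → adj G i j ≡ true →
              (dir i j ≡ true × dir j i ≡ false) ⊎ (dir i j ≡ false × dir j i ≡ true)
open Orientation public

_⊢_⇒_ : ∀ {n} {G : SimpleGraph n} → Orientation G → Fin n → Fin n → Set
ω ⊢ i ⇒ j = dir ω i j ≡ true

Acyclic : ∀ {n} {G : SimpleGraph n} → Orientation G → Set
Acyclic {n} ω = ∀ (i : Fin n) → ¬ TransClosure (ω ⊢_⇒_) i i

-- A directed cycle, given by a representative sequence (i_1,…,i_m) of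
-- distinct vertices, m ≥ 3, consecutive vertices adjacent (mod m).
-- Positions are Fin m (0-based); successor of position j is (j+1) mod m.
record DirectedCycle {n : ℕ} (G : SimpleGraph n) : Set where
  field
    len      : ℕ
    3≤len    : 3 ≤ len
    seq      : Fin len → Fin n
    distinct : Injective _≡_ _≡_ seq
  instance
    len-nonZero : NonZero len
    len-nonZero = >-nonZero (<-≤-trans (s≤s z≤n) 3≤len)
  shiftPos : ℕ → Fin len → Fin len
  shiftPos k j = (toℕ j + k) mod len
  field
    consecutive : ∀ (j : Fin len) → adj G (seq j) (seq (shiftPos 1 j)) ≡ true
open DirectedCycle public

sumℤ : List ℤ → ℤ
sumℤ = foldr _+ℤ_ (⁺ 0)

𝟙 : Bool → ℤ
𝟙 true  = ⁺ 1
𝟙 false = ⁺ 0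

ν : ∀ {n} {G : SimpleGraph n} → DirectedCycle G → Orientation G → ℤ
ν I ω = sumℤ (map (λ j → 𝟙 (dir ω (seq I j) (seq I (shiftPos I 1 j))))
                  (allFin (len I)))
        -ℤ
        sumℤ (map (λ j → 𝟙 (dir ω (seq I (shiftPos I 1 j)) (seq I j)))
                  (allFin (len I)))

record ToricDirectedPath {n : ℕ} {G : SimpleGraph n} (ω : Orientation G)
                         (m : ℕ) .{{_ : NonZero m}} (s : Fin m → Fin n) : Set where
  field
    distinct : Injective _≡_ _≡_ s
    steps    : ∀ (t : Fin m) → toℕ t + 1 < m →
               ω ⊢ s t ⇒ s ((toℕ t + 1) mod m)
    wrap     : ω ⊢ s (0 mod m) ⇒ s ((m ∸ 1) mod m)

cyclicShift : ∀ {n} {G : SimpleGraph n} (I : DirectedCycle G) → Fin (len I) → Fin (len I) → Fin n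
cyclicShift I k j = seq I (shiftPos I (toℕ k) j)

HasToricPathIn : ∀ {n} {G : SimpleGraph n} → Orientation G → DirectedCycle G → Set
HasToricPathIn ω I = Σ (Fin (len I)) λ k → ToricDirectedPath ω (len I) {{len-nonZero I}} (cyclicShift I k)

module Submission where

-- Going once around I, each of its m edges is oriented either along the cycle (i_j → i_{j+1})
-- or against it, so ν_I(ω) = m − 2b where b counts the edges oriented against it; thus
-- ν_I(ω) = m − 2 says exactly that one edge {i_j, i_{j+1}} is reversed.  A cyclic shift is a
-- toric directed path iff all its edges point along the cycle except the closing one between its
-- last and first vertex, which points back from first to last: the shift starting at i_{j+1} is
-- a toric path precisely when {i_j, i_{j+1}} is the unique reversed edge.

open import Defs hiding (sym)
open import Data.Nat using (ℕ; zero; suc; _+_; _∸_; _<_; _≤_; z<s; NonZero; >-nonZero⁻¹)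
import Data.Nat.Properties as ℕ
open import Data.Nat.DivMod using (_%_; _mod_; m%n<n; %-distribˡ-+; m%n%n≡m%n; [m+n]%n≡m%n; m<n⇒m%n≡m)
open import Data.Fin using (Fin; toℕ) renaming (zero to fzero; suc to fsuc)
open import Data.Fin.Properties using (toℕ-injective; toℕ-fromℕ<; fromℕ<-cong; toℕ<n; suc-injective)
open import Data.Integer using (+_; _-_) renaming (_+_ to _+ℤ_)
import Data.Integer.Properties as ℤ
import Data.Integer.Tactic.RingSolver as ℤ-Ring
open import Data.Bool using (Bool; true; false; not)
open import Data.List using (tabulate; allFin; map)
open import Data.List.Properties using (map-tabulate)
open import Data.Product using (_,_; ∃!)
open import Data.Sum using (_⊎_; inj₁; inj₂)
open import Data.Empty using (⊥; ⊥-elim)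
open import Function using (_∘_; _⇔_; mk⇔)
import Function.Properties.Equivalence as ⇔
open import Relation.Binary.PropositionalEquality
  using (_≡_; _≢_; refl; sym; trans; cong; cong₂; subst; subst₂; module ≡-Reasoning)

count : ∀ {m} → (Fin m → Bool) → ℕ
count {zero}  g = 0
count {suc m} g with g fzero
... | true  = suc (count (g ∘ fsuc))
... | false = count (g ∘ fsuc)

sumℤ-𝟙≡count : ∀ {m} (g : Fin m → Bool) → sumℤ (map (𝟙 ∘ g) (allFin m)) ≡ + count g
sumℤ-𝟙≡count {m} g = trans (cong sumℤ (map-tabulate (λ j → j) (𝟙 ∘ g))) (go g)
  where
  go : ∀ {m} (g : Fin m → Bool) → sumℤ (tabulate (𝟙 ∘ g)) ≡ + count g
  go {zero}  g = refl
  go {suc m} g with g fzero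
  ... | true  = cong (+ 1 +ℤ_) (go (g ∘ fsuc))
  ... | false = trans (ℤ.+-identityˡ _) (go (g ∘ fsuc))

count-complement : ∀ {m} (f g : Fin m → Bool) → (∀ j → f j ≡ not (g j)) →
                   count f + count g ≡ m
count-complement {zero}  f g f≡¬g = refl
count-complement {suc m} f g f≡¬g with f fzero | g fzero | f≡¬g fzero
  | count-complement (f ∘ fsuc) (g ∘ fsuc) (f≡¬g ∘ fsuc)
... | true  | false | _ | ih = cong suc ih
... | false | true  | _ | ih = trans (ℕ.+-suc _ _) (cong suc ih)

count≡0⇒false : ∀ {m} (g : Fin m → Bool) → count g ≡ 0 → ∀ j → g j ≡ false
count≡0⇒false {suc m} g c≡0 j with g fzero in g0
count≡0⇒false {suc m} g c≡0 fzero    | false = g0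
count≡0⇒false {suc m} g c≡0 (fsuc j) | false = count≡0⇒false (g ∘ fsuc) c≡0 j

false⇒count≡0 : ∀ {m} (g : Fin m → Bool) → (∀ j → g j ≡ false) → count g ≡ 0
false⇒count≡0 {zero}  g all-false = refl
false⇒count≡0 {suc m} g all-false with g fzero | all-false fzero
... | false | _ = false⇒count≡0 (g ∘ fsuc) (all-false ∘ fsuc)

count≡1⇔∃! : ∀ {m} (g : Fin m → Bool) → count g ≡ 1 ⇔ ∃! _≡_ (λ j → g j ≡ true)
count≡1⇔∃! g = mk⇔ (to g) (from g)
  where
  to : ∀ {m} (g : Fin m → Bool) → count g ≡ 1 → ∃! _≡_ (λ j → g j ≡ true)
  to {suc m} g c≡1 with g fzero in g0
  ... | true  = fzero , g0 , only-zero
    where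
    only-zero : ∀ {j} → g j ≡ true → fzero ≡ j
    only-zero {fzero}  _   = refl
    only-zero {fsuc j} gj with () ← trans (sym gj) (count≡0⇒false (g ∘ fsuc) (ℕ.suc-injective c≡1) j)
  ... | false with to (g ∘ fsuc) c≡1
  ...   | p , gp , unique = fsuc p , gp , only-p
    where
    only-p : ∀ {j} → g j ≡ true → fsuc p ≡ j
    only-p {fzero}  gj with () ← trans (sym gj) g0
    only-p {fsuc j} gj = cong fsuc (unique gj)

  from : ∀ {m} (g : Fin m → Bool) → ∃! _≡_ (λ j → g j ≡ true) → count g ≡ 1
  from {suc m} g (fzero , gp , unique) with g fzero
  ... | true = cong suc (false⇒count≡0 (g ∘ fsuc) rest-false)
    where
    rest-false : ∀ j → g (fsuc j) ≡ false
    rest-false j with g (fsuc j) in gj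
    ... | false = refl
    ... | true  with () ← unique gj
  from {suc m} g (fsuc p , gp , unique) with g fzero in g0
  ... | true  with () ← unique g0
  ... | false = from (g ∘ fsuc) (p , gp , suc-injective ∘ unique)

n+n≡2⇒n≡1 : ∀ n → n + n ≡ 2 → n ≡ 1
n+n≡2⇒n≡1 (suc zero)    _     = refl
n+n≡2⇒n≡1 (suc (suc n)) n+n≡2 = ⊥-elim (ℕ.m+1+n≢0 n (ℕ.suc-injective (ℕ.suc-injective n+n≡2)))

difference≡sum-2⇔≡1 : ∀ a b → (+ a - + b ≡ + (a + b) - + 2) ⇔ b ≡ 1
difference≡sum-2⇔≡1 a b = mk⇔ to from
  where
  open ≡-Reasoning
  sum-difference : ∀ x y → (x +ℤ y) - (x - y) ≡ y +ℤ y
  sum-difference = ℤ-Ring.solve-∀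
  x-[x-2] : ∀ x → x - (x - + 2) ≡ + 2
  x-[x-2] = ℤ-Ring.solve-∀
  x-1 : ∀ x → x - + 1 ≡ (x +ℤ + 1) - + 2
  x-1 = ℤ-Ring.solve-∀

  to : + a - + b ≡ + (a + b) - + 2 → b ≡ 1
  to eq = n+n≡2⇒n≡1 b (ℤ.+-injective (begin
    + (b + b)                              ≡⟨ ℤ.pos-+ b b ⟩
    + b +ℤ + b                             ≡⟨ sum-difference (+ a) (+ b) ⟨
    (+ a +ℤ + b) - (+ a - + b)             ≡⟨ cong ((+ a +ℤ + b) -_) eq ⟩
    (+ a +ℤ + b) - (+ (a + b) - + 2)       ≡⟨ cong (λ s → (+ a +ℤ + b) - (s - + 2)) (ℤ.pos-+ a b) ⟩
    (+ a +ℤ + b) - ((+ a +ℤ + b) - + 2)    ≡⟨ x-[x-2] (+ a +ℤ + b) ⟩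
    + 2                                    ∎))

  from : b ≡ 1 → + a - + b ≡ + (a + b) - + 2
  from refl = begin
    + a - + 1                ≡⟨ x-1 (+ a) ⟩
    (+ a +ℤ + 1) - + 2       ≡⟨ cong (_- + 2) (ℤ.pos-+ a 1) ⟨
    + (a + 1) - + 2          ∎

module Rotation (m : ℕ) .{{_ : NonZero m}} where

  toℕ-mod : ∀ a → toℕ (a mod m) ≡ a % m
  toℕ-mod a = toℕ-fromℕ< (m%n<n a m)

  mod-cong : ∀ {a b} → a % m ≡ b % m → a mod m ≡ b mod m
  mod-cong {a} {b} eq = fromℕ<-cong (a % m) (b % m) eq (m%n<n a m) (m%n<n b m)

  mod-toℕ : ∀ j → toℕ j mod m ≡ j
  mod-toℕ j = toℕ-injective (trans (toℕ-mod (toℕ j)) (m<n⇒m%n≡m (toℕ<n j)))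

  [a%m+b]%m≡[a+b]%m : ∀ a b → (a % m + b) % m ≡ (a + b) % m
  [a%m+b]%m≡[a+b]%m a b = begin
    (a % m + b) % m          ≡⟨ %-distribˡ-+ (a % m) b m ⟩
    (a % m % m + b % m) % m  ≡⟨ cong (λ r → (r + b % m) % m) (m%n%n≡m%n a m) ⟩
    (a % m + b % m) % m      ≡⟨ %-distribˡ-+ a b m ⟨
    (a + b) % m              ∎
    where open ≡-Reasoning

  -- Definitionally the shiftPos of a cycle of length m, so ν's summands are 𝟙 ∘ forward and
  -- 𝟙 ∘ backward below.
  rotate : ℕ → Fin m → Fin m
  rotate k j = (toℕ j + k) mod m

  rotate-mod : ∀ k a → rotate k (a mod m) ≡ (a + k) mod m
  rotate-mod k a =
    mod-cong (trans (cong (λ r → (r + k) % m) (toℕ-mod a)) ([a%m+b]%m≡[a+b]%m a k))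

  rotate-rotate : ∀ a b j → rotate a (rotate b j) ≡ rotate (b + a) j
  rotate-rotate a b j = trans (rotate-mod a (toℕ j + b)) (cong (_mod m) (ℕ.+-assoc (toℕ j) b a))

  rotate-full : ∀ j → rotate m j ≡ j
  rotate-full j = trans (mod-cong ([m+n]%n≡m%n (toℕ j) m)) (mod-toℕ j)

  rotate-cancel : ∀ {a b} → b + a ≡ m → ∀ j → rotate a (rotate b j) ≡ j
  rotate-cancel {a} {b} b+a≡m j =
    trans (rotate-rotate a b j) (trans (cong (λ k → rotate k j) b+a≡m) (rotate-full j))

  rotate-injective : ∀ {k i j} → k ≤ m → rotate k i ≡ rotate k j → i ≡ j
  rotate-injective {k} {i} {j} k≤m eq = begin
    i                               ≡⟨ rotate-cancel (ℕ.m+[n∸m]≡n k≤m) i ⟨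
    rotate (m ∸ k) (rotate k i)     ≡⟨ cong (rotate (m ∸ k)) eq ⟩
    rotate (m ∸ k) (rotate k j)     ≡⟨ rotate-cancel (ℕ.m+[n∸m]≡n k≤m) j ⟩
    j                               ∎
    where open ≡-Reasoning

  rotate-comm : ∀ a b j → rotate a (rotate b j) ≡ rotate b (rotate a j)
  rotate-comm a b j = begin
    rotate a (rotate b j)   ≡⟨ rotate-rotate a b j ⟩
    rotate (b + a) j        ≡⟨ cong (λ k → rotate k j) (ℕ.+-comm b a) ⟩
    rotate (a + b) j        ≡⟨ rotate-rotate b a j ⟨
    rotate b (rotate a j)   ∎
    where open ≡-Reasoning

  1≤m : 1 ≤ m
  1≤m = >-nonZero⁻¹ m

  prev : Fin m → Fin m
  prev = rotate (m ∸ 1)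

  rotate-prev : ∀ j → rotate 1 (prev j) ≡ j
  rotate-prev = rotate-cancel (ℕ.m∸n+n≡m 1≤m)

  prev-rotate : ∀ j → prev (rotate 1 j) ≡ j
  prev-rotate = rotate-cancel (ℕ.m+[n∸m]≡n 1≤m)

  last : Fin m
  last = (m ∸ 1) mod m

  toℕ-last : toℕ last ≡ m ∸ 1
  toℕ-last = trans (toℕ-mod (m ∸ 1)) (m<n⇒m%n≡m (ℕ.∸-monoʳ-< z<s 1≤m))

  rotate-zero : ∀ k → rotate (toℕ k) (0 mod m) ≡ k
  rotate-zero k = trans (rotate-mod (toℕ k) 0) (mod-toℕ k)

  rotate-last : ∀ k → rotate (toℕ k) last ≡ prev k
  rotate-last k = trans (rotate-mod (toℕ k) (m ∸ 1)) (cong (_mod m) (ℕ.+-comm (m ∸ 1) (toℕ k)))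

  +1<⇒≢last : ∀ {t} → toℕ t + 1 < m → t ≢ last
  +1<⇒≢last {t} t+1<m refl = ℕ.<-irrefl (ℕ.m∸n+n≡m 1≤m) (subst (λ r → r + 1 < m) toℕ-last t+1<m)

  +1<⊎≡last : ∀ t → toℕ t + 1 < m ⊎ t ≡ last
  +1<⊎≡last t with ℕ.m≤n⇒m<n∨m≡n (toℕ<n t)
  ... | inj₁ 1+t<m = inj₁ (subst (_< m) (ℕ.+-comm 1 (toℕ t)) 1+t<m)
  ... | inj₂ 1+t≡m = inj₂ (trans (sym (mod-toℕ t)) (cong (_mod m) (cong (_∸ 1) 1+t≡m)))

module _ {n} {G : SimpleGraph n} (I : DirectedCycle G) (ω : Orientation G) where
  private
    instance
      len-nonZero′ : NonZero (len I)
      len-nonZero′ = len-nonZero I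
  open Rotation (len I)

  forward backward : Fin (len I) → Bool
  forward  j = dir ω (seq I j) (seq I (rotate 1 j))
  backward j = dir ω (seq I (rotate 1 j)) (seq I j)

  forward≡not-backward : ∀ j → forward j ≡ not (backward j)
  forward≡not-backward j with adj⇒dir ω _ _ (consecutive I j)
  ... | inj₁ (f≡true , b≡false) rewrite f≡true | b≡false = refl
  ... | inj₂ (f≡false , b≡true) rewrite f≡false | b≡true = refl

  ¬forward∧backward : ∀ j → forward j ≡ true → backward j ≡ true → ⊥
  ¬forward∧backward j fj bj with () ← trans (sym fj) (trans (forward≡not-backward j) (cong not bj))

  ν≡count-forward-count-backward : ν I ω ≡ + count forward - + count backward
  ν≡count-forward-count-backward = cong₂ _-_ (sumℤ-𝟙≡count forward) (sumℤ-𝟙≡count backward)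

  ν≡len-2⇔count-backward≡1 : (ν I ω ≡ + len I - + 2) ⇔ count backward ≡ 1
  ν≡len-2⇔count-backward≡1 =
    subst (λ L → (ν I ω ≡ + L - + 2) ⇔ count backward ≡ 1)
          (count-complement forward backward forward≡not-backward)
          (subst (λ x → (x ≡ + (count forward + count backward) - + 2) ⇔ count backward ≡ 1)
                 (sym ν≡count-forward-count-backward)
                 (difference≡sum-2⇔≡1 (count forward) (count backward)))

  toricPath⇒∃!backward : ∀ {k} → ToricDirectedPath ω (len I) (cyclicShift I k) →
                         ∃! _≡_ (λ j → backward j ≡ true)
  toricPath⇒∃!backward {k} path = prev k , backward-prev , only-prev
    where
    open ToricDirectedPath path
    K = toℕ k

    backward-prev : backward (prev k) ≡ true
    backward-prev = subst₂ (λ x y → ω ⊢ seq I x ⇒ seq I y)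
                           (trans (rotate-zero k) (sym (rotate-prev k))) (rotate-last k) wrap

    only-prev : ∀ {j} → backward j ≡ true → prev k ≡ j
    only-prev {j} bj = at-position (rotate (len I ∸ K) j) (rotate-cancel (ℕ.m∸n+n≡m (ℕ.<⇒≤ (toℕ<n k))) j)
      where
      at-position : ∀ t → rotate K t ≡ j → prev k ≡ j
      at-position t refl with +1<⊎≡last t
      ... | inj₁ t+1<m = ⊥-elim (¬forward∧backward (rotate K t) forward-at bj)
        where
        forward-at : forward (rotate K t) ≡ true
        forward-at = subst (λ x → ω ⊢ seq I (rotate K t) ⇒ seq I x) (rotate-comm K 1 t) (steps t t+1<m)
      ... | inj₂ refl = sym (rotate-last k)

  ∃!backward⇒toricPath : ∀ {p} → backward p ≡ true → (∀ {j} → backward j ≡ true → p ≡ j) →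
                         ToricDirectedPath ω (len I) (cyclicShift I (rotate 1 p))
  ∃!backward⇒toricPath {p} bp only-p = record
    { distinct = rotate-injective K≤m ∘ distinct I
    ; steps    = step
    ; wrap     = subst₂ (λ x y → ω ⊢ seq I x ⇒ seq I y) (sym (rotate-zero k)) (sym last↦p) bp
    }
    where
    k = rotate 1 p
    K = toℕ k
    K≤m : K ≤ len I
    K≤m = ℕ.<⇒≤ (toℕ<n k)

    last↦p : rotate K last ≡ p
    last↦p = trans (rotate-last k) (prev-rotate p)

    step : ∀ t → toℕ t + 1 < len I → ω ⊢ seq I (rotate K t) ⇒ seq I (rotate K (rotate 1 t))
    step t t+1<m with backward (rotate K t) in bt
    ... | true  = ⊥-elim (+1<⇒≢last t+1<m (rotate-injective K≤m (trans (sym (only-p bt)) (sym last↦p))))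
    ... | false = subst (λ x → ω ⊢ seq I (rotate K t) ⇒ seq I x) (sym (rotate-comm K 1 t))
                        (trans (forward≡not-backward (rotate K t)) (cong not bt))

  hasToricPath⇔∃!backward : HasToricPathIn ω I ⇔ ∃! _≡_ (λ j → backward j ≡ true)
  hasToricPath⇔∃!backward = mk⇔ (λ (_ , path) → toricPath⇒∃!backward path)
                                (λ (p , bp , only-p) → rotate 1 p , ∃!backward⇒toricPath bp only-p)

corollary4p5 : ∀ {n : ℕ} (G : SimpleGraph n) (I : DirectedCycle G)
                 (ω : Orientation G) → Acyclic ω →
                 HasToricPathIn ω I ⇔ (ν I ω ≡ + len I - + 2)
corollary4p5 G I ω _ =
  ⇔.trans (hasToricPath⇔∃!backward I ω)
          (⇔.sym (⇔.trans (ν≡len-2⇔count-backward≡1 I ω) (count≡1⇔∃! (backward I ω))))
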